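{- Let $k,m,n,u$ be positive integers and let $A\in\{0,1\}^{m\times kn}$ be a $(k,u)$-complete matrix. Let $P\in\{0,1\}^{l\times k}$ and $a\in[l-1]$, and let $P'=P([a]\times[k])$ (the first $a$ rows) and $P''=P([a+1,l]\times[k])$ (the last $l-a$ rows). Suppose $P'$ has a block-respecting embedding $(f',g')$ in $A$ and $P''$ has a block-respecting embedding $(f'',g'')$ in $A$. If $f'(a)<f''(1)$, and $g'(b)=g''(b)$ for every column $b\in[k]$ in which both $P'$ and $P''$ have a 1-entry, then $P$ has a block-respecting embedding in $A$.
   Context: For $I\subseteq[m]$, $J\subseteq[N]$, $A(I\times J)$ denotes the submatrix of $A$ induced by rows $I$ and columns $J$; $[n]=\{1,\dots,n\}$ and $[m,n]=\{m,\dots,n\}$. A matrix $A\in\{0,1\}^{m\times kn}$ is viewed as the union of $k$ vertical blocks $A([m]\times[(j-1)n+1,jn])$, $j\in[k]$; it is $(k,u)$-complete if for every row and every vertical block, the $n$ entries in their intersection include at least $u$ 1-entries. For $Q\in\{0,1\}^{l\times k}$, a block-respecting embedding of $Q$ in $A$ is a pair of functions $(f,g)$ with $f:[l]\to[m]$ strictly increasing, $g:[k]\to[kn]$ satisfying $(j-1)n<g(j)\le jn$ for all $j\in[k]$, and $A(f(i),g(j))=1$ whenever $Q(i,j)=1$. -}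

module Defs where

open import Data.Nat using (ℕ; zero; suc; _+_; _*_; _∸_; _≤_; _<_)
open import Data.Bool using (Bool; true; false)
open import Data.List using (List; length; map; upTo; filterᵇ)
open import Data.Product using (Σ; _×_; ∃-syntax)
open import Relation.Binary.PropositionalEquality using (_≡_)

-- A 0/1 matrix, 1-indexed: entry (i , j) is M i j (true = 1-entry).
-- Only entries with indices in the declared ranges are meaningful.
Matrix : Set
Matrix = ℕ → ℕ → Bool

blockCols : ℕ → ℕ → List ℕ
blockCols n j = map (λ t → (j ∸ 1) * n + suc t) (upTo n)

onesInBlock : Matrix → ℕ → ℕ → ℕ → ℕ
onesInBlock A n i j = length (filterᵇ (A i) (blockCols n j))

Complete : (m k n u : ℕ) → Matrix → Set
Complete m k n u A =
  ∀ i j → 1 ≤ i → i ≤ m → 1 ≤ j → j ≤ k → u ≤ onesInBlock A n i j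

IsBREmbedding : (l k : ℕ) → Matrix → (m n : ℕ) → Matrix → (ℕ → ℕ) → (ℕ → ℕ) → Set
IsBREmbedding l k Q m n A f g =
  (∀ i → 1 ≤ i → i ≤ l → 1 ≤ f i × f i ≤ m)
  × (∀ i i' → 1 ≤ i → i < i' → i' ≤ l → f i < f i')
  × (∀ j → 1 ≤ j → j ≤ k → (j ∸ 1) * n < g j × g j ≤ j * n)
  × (∀ i j → 1 ≤ i → i ≤ l → 1 ≤ j → j ≤ k → Q i j ≡ true → A (f i) (g j) ≡ true)

HasBREmbedding : (l k : ℕ) → Matrix → (m n : ℕ) → Matrix → Set
HasBREmbedding l k Q m n A = Σ (ℕ → ℕ) λ f → Σ (ℕ → ℕ) λ g → IsBREmbedding l k Q m n A f g

-- P' = P([a] × [k]) : first a rows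
topRows : Matrix → ℕ → Matrix
topRows P a i j = P i j

bottomRows : Matrix → ℕ → Matrix
bottomRows P a i j = P (a + i) j

HasOneInColumn : ℕ → Matrix → ℕ → Set
HasOneInColumn l Q b = ∃[ i ] (1 ≤ i × i ≤ l × Q i b ≡ true)

module Submission where

-- Rows of P are embedded by stacking the two row maps: rows 1..a go through f',
-- row i > a goes through f'' (i ∸ a).  Because f' a < f'' 1, the stacked map is
-- still strictly increasing.  A column b is sent to g' b if the top part P'
-- has a 1-entry in column b and to g'' b otherwise; both choices respect the
-- block of b, and by the agreement hypothesis the two choices coincide whenever
-- the bottom part P'' also needs column b.  Hence every 1-entry of P lands on
-- a 1-entry of A.

open import Defs
open import Data.Nat using (ℕ; suc; _+_; _*_; _∸_; _≤_; _<_; _≤?_; s≤s)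
open import Data.Nat.Properties
  using (≤-refl; <⇒≤; <-trans; ≤-<-connex; ≰⇒>; <⇒≱; m<n⇒0<n∸m; ∸-monoˡ-≤; ∸-monoˡ-<;
         m+[n∸m]≡n; m≤n⇒m<n∨m≡n; anyUpTo?; module ≤-Reasoning)
open import Data.Bool using (true) renaming (_≟_ to _≟ᵇ_)
open import Data.Product using (_×_; _,_; ∃-syntax)
open import Data.Sum using (inj₁; inj₂)
open import Relation.Nullary using (Dec; yes; no; ¬_; contradiction)
open import Relation.Nullary.Decidable using (map′; _×-dec_)
open import Relation.Binary.PropositionalEquality using (_≡_; refl; sym; subst)

select : {T : ℕ → Set} → (∀ j → Dec (T j)) → (ℕ → ℕ) → (ℕ → ℕ) → ℕ → ℕ
select T? g' g'' j with T? j
... | yes _ = g' j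
... | no _  = g'' j

select-yes : {T : ℕ → Set} (T? : ∀ j → Dec (T j)) {g' g'' : ℕ → ℕ} {j : ℕ} →
  T j → select T? g' g'' j ≡ g' j
select-yes T? {j = j} t with T? j
... | yes _ = refl
... | no ¬t = contradiction t ¬t

select-no : {T : ℕ → Set} (T? : ∀ j → Dec (T j)) {g' g'' : ℕ → ℕ} {j : ℕ} →
  ¬ T j → select T? g' g'' j ≡ g'' j
select-no T? {j = j} ¬t with T? j
... | yes t = contradiction t ¬t
... | no _  = refl

select-agree : {T : ℕ → Set} (T? : ∀ j → Dec (T j)) {g' g'' : ℕ → ℕ} {j : ℕ} →
  (T j → g' j ≡ g'' j) → select T? g' g'' j ≡ g'' j
select-agree T? {j = j} agree with T? j
... | yes t = agree t
... | no _  = refl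

select-elim : {T : ℕ → Set} (T? : ∀ j → Dec (T j)) {g' g'' : ℕ → ℕ} (R : ℕ → ℕ → Set) →
  (∀ j → T j → R j (g' j)) → (∀ j → ¬ T j → R j (g'' j)) →
  ∀ j → R j (select T? g' g'' j)
select-elim T? R r' r'' j with T? j
... | yes t = r' j t
... | no ¬t = r'' j ¬t

StrictlyIncreasingOn : ℕ → (ℕ → ℕ) → Set
StrictlyIncreasingOn L h = ∀ i i' → 1 ≤ i → i < i' → i' ≤ L → h i < h i'

strict⇒monotone : ∀ {L h} → StrictlyIncreasingOn L h →
  ∀ i i' → 1 ≤ i → i ≤ i' → i' ≤ L → h i ≤ h i'
strict⇒monotone s i i' 1≤i i≤i' i'≤L with m≤n⇒m<n∨m≡n i≤i'
... | inj₁ i<i' = <⇒≤ (s i i' 1≤i i<i' i'≤L)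
... | inj₂ refl = ≤-refl

belowCut : ∀ {a i l} → a < i → i ≤ l → 1 ≤ i ∸ a × i ∸ a ≤ l ∸ a
belowCut {a} a<i i≤l = m<n⇒0<n∸m a<i , ∸-monoˡ-≤ a i≤l

-- The stacked map is used only through `stack-top`, `stack-bottom` and
-- `stack-rows`; keeping it opaque lets Agda infer its arguments from its uses.
opaque
  stack : ℕ → (ℕ → ℕ) → (ℕ → ℕ) → ℕ → ℕ
  stack a f' f'' = select (_≤? a) f' (λ i → f'' (i ∸ a))

  stack-top : ∀ {a f' f'' i} → i ≤ a → stack a f' f'' i ≡ f' i
  stack-top {a} {f'} {f''} = select-yes (_≤? a) {f'} {λ i → f'' (i ∸ a)}

  stack-bottom : ∀ {a f' f'' i} → a < i → stack a f' f'' i ≡ f'' (i ∸ a)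
  stack-bottom {a} {f'} {f''} a<i = select-no (_≤? a) {f'} {λ i → f'' (i ∸ a)} (<⇒≱ a<i)

  stack-rows : ∀ {a l f' f''} (R : ℕ → ℕ → Set) →
    (∀ i → 1 ≤ i → i ≤ a → R i (f' i)) →
    (∀ i → 1 ≤ i → i ≤ l ∸ a → R (a + i) (f'' i)) →
    ∀ i → 1 ≤ i → i ≤ l → R i (stack a f' f'' i)
  stack-rows {a} {l} {f'} {f''} R top bottom =
    select-elim (_≤? a) {f'} {λ i → f'' (i ∸ a)} (λ i x → 1 ≤ i → i ≤ l → R i x)
      (λ i i≤a 1≤i _ → top i 1≤i i≤a)
      (λ i i≰a _ i≤l → let a<i = ≰⇒> i≰a
                           (1≤i-a , i-a≤l-a) = belowCut a<i i≤l
                       in subst (λ r → R r (f'' (i ∸ a))) (m+[n∸m]≡n (<⇒≤ a<i))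
                                (bottom (i ∸ a) 1≤i-a i-a≤l-a))

stack-strict : ∀ {a l f' f''} →
  StrictlyIncreasingOn a f' → StrictlyIncreasingOn (l ∸ a) f'' → f' a < f'' 1 →
  StrictlyIncreasingOn l (stack a f' f'')
stack-strict {a} {l} {f'} {f''} s' s'' cut i i' 1≤i i<i' i'≤l
  with ≤-<-connex i a | ≤-<-connex i' a
... | inj₁ i≤a | inj₁ i'≤a = begin-strict
  stack a f' f'' i   ≡⟨ stack-top i≤a ⟩
  f' i               <⟨ s' i i' 1≤i i<i' i'≤a ⟩
  f' i'              ≡⟨ sym (stack-top i'≤a) ⟩
  stack a f' f'' i'  ∎
  where open ≤-Reasoning
... | inj₁ i≤a | inj₂ a<i' = begin-strict
  stack a f' f'' i   ≡⟨ stack-top i≤a ⟩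
  f' i               ≤⟨ strict⇒monotone s' i a 1≤i i≤a ≤-refl ⟩
  f' a               <⟨ cut ⟩
  f'' 1              ≤⟨ strict⇒monotone s'' 1 (i' ∸ a) ≤-refl 1≤i'-a i'-a≤l-a ⟩
  f'' (i' ∸ a)       ≡⟨ sym (stack-bottom a<i') ⟩
  stack a f' f'' i'  ∎
  where
  open ≤-Reasoning
  1≤i'-a : 1 ≤ i' ∸ a
  1≤i'-a = m<n⇒0<n∸m a<i'
  i'-a≤l-a : i' ∸ a ≤ l ∸ a
  i'-a≤l-a = ∸-monoˡ-≤ a i'≤l
... | inj₂ a<i | inj₁ i'≤a = contradiction i'≤a (<⇒≱ (<-trans a<i i<i'))
... | inj₂ a<i | inj₂ a<i' = begin-strict
  stack a f' f'' i   ≡⟨ stack-bottom a<i ⟩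
  f'' (i ∸ a)        <⟨ s'' (i ∸ a) (i' ∸ a) (m<n⇒0<n∸m a<i) (∸-monoˡ-< i<i' (<⇒≤ a<i))
                           (∸-monoˡ-≤ a i'≤l) ⟩
  f'' (i' ∸ a)       ≡⟨ sym (stack-bottom a<i') ⟩
  stack a f' f'' i'  ∎
  where open ≤-Reasoning

hasOneInColumn? : ∀ l (Q : Matrix) b → Dec (HasOneInColumn l Q b)
hasOneInColumn? l Q b =
  map′ fromSearch toSearch (anyUpTo? (λ i → 1 ≤? i ×-dec (Q i b ≟ᵇ true)) (suc l))
  where
  fromSearch : ∃[ i ] (i < suc l × 1 ≤ i × Q i b ≡ true) → HasOneInColumn l Q b
  fromSearch (i , s≤s i≤l , 1≤i , e) = i , 1≤i , i≤l , e
  toSearch : HasOneInColumn l Q b → ∃[ i ] (i < suc l × 1 ≤ i × Q i b ≡ true)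
  toSearch (i , 1≤i , i≤l , e) = i , s≤s i≤l , 1≤i , e

lemma1 : (k m n u : ℕ) → 1 ≤ k → 1 ≤ m → 1 ≤ n → 1 ≤ u →
    (A : Matrix) → Complete m k n u A →
    (l : ℕ) (P : Matrix) (a : ℕ) → 1 ≤ a → a ≤ l ∸ 1 →
    (f' g' f'' g'' : ℕ → ℕ) →
    IsBREmbedding a k (topRows P a) m n A f' g' →
    IsBREmbedding (l ∸ a) k (bottomRows P a) m n A f'' g'' →
    f' a < f'' 1 →
    (∀ b → 1 ≤ b → b ≤ k →
      HasOneInColumn a (topRows P a) b →
      HasOneInColumn (l ∸ a) (bottomRows P a) b →
      g' b ≡ g'' b) →
    HasBREmbedding l k P m n A
lemma1 k m n u _ _ _ _ A _ l P a _ _ f' g' f'' g''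
  (rows' , strict' , blocks' , ones') (rows'' , strict'' , blocks'' , ones'') cut agree =
  f , g ,
  stack-rows (λ _ x → 1 ≤ x × x ≤ m) rows' rows'' ,
  stack-strict strict' strict'' cut ,
  select-elim inTop? (λ j x → 1 ≤ j → j ≤ k → (j ∸ 1) * n < x × x ≤ j * n)
    (λ j _ → blocks' j) (λ j _ → blocks'' j) ,
  onesPreserved
  where
  inTop? : ∀ b → Dec (HasOneInColumn a (topRows P a) b)
  inTop? = hasOneInColumn? a (topRows P a)

  f g : ℕ → ℕ
  f = stack a f' f''
  g = select inTop? g' g''

  -- A 1-entry of P in the top part uses column j, so g j = g' j; in the bottom
  -- part g j = g'' j, because g' j = g'' j whenever the top part uses column j.
  onesPreserved : ∀ i j → 1 ≤ i → i ≤ l → 1 ≤ j → j ≤ k → P i j ≡ true → A (f i) (g j) ≡ true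
  onesPreserved i j 1≤i i≤l 1≤j j≤k =
    stack-rows (λ i x → P i j ≡ true → A x (g j) ≡ true)
      (λ i 1≤i i≤a e → subst (λ y → A (f' i) y ≡ true)
         (sym (select-yes inTop? (i , 1≤i , i≤a , e)))
         (ones' i j 1≤i i≤a 1≤j j≤k e))
      (λ i 1≤i i≤l-a e → subst (λ y → A (f'' i) y ≡ true)
         (sym (select-agree inTop? λ top → agree j 1≤j j≤k top (i , 1≤i , i≤l-a , e)))
         (ones'' i j 1≤i i≤l-a 1≤j j≤k e))
      i 1≤i i≤l
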